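{- For any language $L\subseteq\mathbb{S}$, $L\in\mathbf{BPP}$ if and only if $L=\mathcal{L}(f)$ for some non-erratic random function $f\in\mathbf{RFP}$.
   Context: $\mathbb{S}=\{0,1\}^*$; $\mathbb{D}(\mathbb{S})$ is the set of probability distributions on $\mathbb{S}$; a random function is a map $\mathbb{S}\to\mathbb{D}(\mathbb{S})$. A probabilistic Turing machine (PTM) $\mathscr M$ computes the random function $f_{\mathscr M}$, $f_{\mathscr M}(\sigma)(\tau)=\Pr[\mathscr M(\sigma)=\tau]$; $\mathbf{RFP}$ is the class of random functions computed by polynomial-time PTMs. For a random function $f$, $\mathcal{L}(f)=\{\sigma\mid f(\sigma)(\epsilon)>1/2\}$. $f$ is non-erratic if for every $\sigma\in\mathbb S$ there is $\tau\in\mathbb S$ with $f(\sigma)(\tau)\ge 2/3$. $\mathbf{BPP}$ is the class of $L\subseteq\mathbb S$ for which there is a polynomial-time PTM $\mathscr M$ with $\Pr[\mathscr M(\sigma)=\chi_L(\sigma)]\ge 2/3$ for all $\sigma$, where $\chi_L$ is the characteristic function of $L$. -}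

module Defs where

open import Data.Bool using (Bool; true; false)
open import Data.Nat using (ℕ; zero; suc; _+_; _*_; _^_)
open import Data.Nat.Properties using (m^n≢0)
open import Data.Integer using (+_)
open import Data.Fin using (Fin)
open import Data.List using (List; []; _∷_; length; map; filter; _++_)
open import Data.List.Properties using () renaming (≡-dec to List-≡-dec)
open import Data.Maybe using (Maybe; just; nothing; Is-just)
open import Data.Maybe.Properties using () renaming (≡-dec to Maybe-≡-dec)
open import Data.Bool.Properties using () renaming (_≟_ to _≟B_)
open import Data.Product using (Σ; _×_; _,_)
open import Data.Vec using (Vec; toList)
open import Data.Rational using (ℚ; _/_; _≤_; _<_)
open import Function.Bundles using (_⇔_)
open import Relation.Binary.PropositionalEquality using (_≡_)

𝕊 : Set
𝕊 = List Bool

-- At every step the machine reads the current state, the scanned symbol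
-- and one fair coin bit; δ either halts (nothing) or gives the next
-- state, the symbol to write and a head move.

Sym : Set
Sym = Maybe Bool          -- nothing = blank

data Move : Set where
  left right stay : Move

record Tape : Set where
  constructor tape
  field
    lft : List Sym        -- cells left of the head, nearest first
    cur : Sym
    rgt : List Sym        -- cells right of the head, nearest first
open Tape public

write : Sym → Tape → Tape
write s (tape l _ r) = tape l s r

move : Move → Tape → Tape
move left  (tape []      c r) = tape [] nothing (c ∷ r)
move left  (tape (x ∷ l) c r) = tape l x (c ∷ r)
move right (tape l c [])      = tape (c ∷ l) nothing []
move right (tape l c (x ∷ r)) = tape (c ∷ l) x r
move stay  t                  = t

initTape : 𝕊 → Tape
initTape []      = tape [] nothing []
initTape (b ∷ σ) = tape [] (just b) (map just σ)

readBits : List Sym → 𝕊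
readBits []             = []
readBits (nothing ∷ _)  = []
readBits (just b ∷ xs)  = b ∷ readBits xs

output : Tape → 𝕊
output (tape _ c r) = readBits (c ∷ r)

record PTM : Set where
  field
    Q     : ℕ
    start : Fin Q
    δ     : Fin Q → Sym → Bool → Maybe (Fin Q × Sym × Move)
open PTM public

-- run with a given sequence of coin flips (one per step);
-- 'just τ' iff the machine halts with output τ before the coins run out
run : (M : PTM) → List Bool → Fin (Q M) → Tape → Maybe 𝕊
run M []       q t = nothing
run M (c ∷ cs) q t with δ M q (cur t) c
... | nothing             = just (output t)
... | just (q' , s , m)   = run M cs q' (move m (write s t))

exec : (M : PTM) → 𝕊 → List Bool → Maybe 𝕊
exec M σ cs = run M cs (start M) (initTape σ)

HaltsWithin : PTM → ℕ → 𝕊 → Set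
HaltsWithin M t σ = (cs : Vec Bool t) → Is-just (exec M σ (toList cs))

record PolyPTM : Set where
  field
    machine : PTM
    k       : ℕ
    halts   : ∀ σ → HaltsWithin machine (k * length σ ^ k + k) σ
open PolyPTM public

bound : PolyPTM → 𝕊 → ℕ
bound P σ = k P * length σ ^ k P + k P

coins : ℕ → List (List Bool)
coins zero    = [] ∷ []
coins (suc t) = map (true ∷_) (coins t) ++ map (false ∷_) (coins t)

-- Pr[M(σ) = τ] = f_M(σ)(τ): fraction of the 2^T equally likely coin
-- sequences (T = the time bound, which all runs respect) giving output τ.
Pr : PolyPTM → 𝕊 → 𝕊 → ℚ
Pr P σ τ = _/_ (+ length (filter (λ cs → Maybe-≡-dec (List-≡-dec _≟B_) (exec (machine P) σ cs) (just τ))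
                             (coins (bound P σ))))
           (2 ^ bound P σ) {{m^n≢0 2 (bound P σ)}}

Language : Set
Language = 𝕊 → Bool

-- χ_L(σ) as a string: "1" or "0"
χ : Language → 𝕊 → 𝕊
χ L σ = L σ ∷ []

BPP : Language → Set
BPP L = Σ PolyPTM λ P → ∀ σ → (+ 2 / 3) ≤ Pr P σ (χ L σ)

NonErratic : PolyPTM → Set
NonErratic P = ∀ σ → Σ 𝕊 λ τ → (+ 2 / 3) ≤ Pr P σ τ

InL : PolyPTM → 𝕊 → Set
InL P σ = (+ 1 / 2) < Pr P σ []

-- A polynomial-time machine can be extended by two steps so that its output is replaced by a
-- function of the first output symbol. Each coin sequence of the old machine prefixes equally
-- many coin sequences of the new one, so an output τ is at most as likely as its image. An output
-- of probability ≥ 2/3 leaves probability ≤ 1/3 to every other output, hence ε has probability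
-- > 1/2 exactly when it is the likely output. So a BPP machine recoded by 1 ↦ ε is non-erratic and
-- accepts L, and a non-erratic machine for L recoded by ε ↦ 1, nonempty ↦ 0 decides L in BPP.
module Submission where

open import Defs
open import Data.Bool using (Bool; true; false; if_then_else_)
open import Data.Bool.Properties using () renaming (_≟_ to _≟B_)
open import Data.Fin using (Fin; zero; suc)
open import Data.Integer as ℤ using (+_; +≤+; +<+)
import Data.Integer.Properties as ℤ
open import Data.List using (List; []; _∷_; length; map; filter; _++_; take; drop)
open import Data.List.Properties using (filter-++; length-++; length-take; length-drop; take++drop≡id) renaming (≡-dec to List-≡-dec)
open import Data.Maybe using (Maybe; just; nothing; Is-just)
open import Data.Maybe.Properties using (just-injective) renaming (≡-dec to Maybe-≡-dec)
open import Data.Maybe.Relation.Unary.Any using (just)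
open import Data.Nat using (ℕ; zero; suc; _+_; _*_; _^_; _∸_; _≤_; _<_; z≤n; s≤s; NonZero)
open import Data.Nat.Properties
open import Data.Nat.Tactic.RingSolver using (solve-∀)
open import Data.Product using (Σ; ∃; _×_; _,_)
open import Data.Rational as ℚ using (_/_; toℚᵘ)
import Data.Rational.Properties as ℚ
open import Data.Rational.Unnormalised as ℚᵘ using (mkℚᵘ; *≤*; *<*) renaming (_≃_ to _≃ᵘ_)
import Data.Rational.Unnormalised.Properties as ℚᵘ
open import Data.Vec using (toList; fromList)
open import Data.Vec.Properties using (toList∘fromList; length-toList)
open import Function using (_∘_)
open import Function.Bundles using (_⇔_; mk⇔; Equivalence)
import Function.Properties.Equivalence as ⇔
open import Relation.Nullary using (does; yes; no; contradiction)
open import Relation.Nullary.Decidable using (dec-true)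
open import Relation.Unary using (Pred; Decidable)
open import Relation.Binary.PropositionalEquality

coinSum : ℕ → (List Bool → ℕ) → ℕ
coinSum zero    F = F []
coinSum (suc t) F = coinSum t (F ∘ (true ∷_)) + coinSum t (F ∘ (false ∷_))

coinSum-mono : ∀ t {F G} → (∀ cs → length cs ≡ t → F cs ≤ G cs) → coinSum t F ≤ coinSum t G
coinSum-mono zero    F≤G = F≤G [] refl
coinSum-mono (suc t) F≤G = +-mono-≤ (coinSum-mono t (λ cs → F≤G (true ∷ cs) ∘ cong suc))
                                     (coinSum-mono t (λ cs → F≤G (false ∷ cs) ∘ cong suc))

coinSum-+ : ∀ t F G → coinSum t (λ cs → F cs + G cs) ≡ coinSum t F + coinSum t G
coinSum-+ zero    F G = refl
coinSum-+ (suc t) F G = trans (cong₂ _+_ (coinSum-+ t _ _) (coinSum-+ t _ _))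
                              (interchange (coinSum t _) (coinSum t _) (coinSum t _) (coinSum t _))
  where interchange : ∀ a b c d → (a + b) + (c + d) ≡ (a + c) + (b + d)
        interchange = solve-∀

coinSum-* : ∀ t c F → coinSum t (λ cs → c * F cs) ≡ c * coinSum t F
coinSum-* zero    c F = refl
coinSum-* (suc t) c F = trans (cong₂ _+_ (coinSum-* t c _) (coinSum-* t c _)) (sym (*-distribˡ-+ c _ _))

coinSum-const : ∀ t c → coinSum t (λ _ → c) ≡ 2 ^ t * c
coinSum-const zero    c = sym (+-identityʳ c)
coinSum-const (suc t) c = trans (cong₂ _+_ (coinSum-const t c) (coinSum-const t c)) (double (2 ^ t) c)
  where double : ∀ x c → x * c + x * c ≡ (2 * x) * c
        double = solve-∀

coinSum-++ : ∀ t d F → coinSum (t + d) F ≡ coinSum t (λ as → coinSum d (λ bs → F (as ++ bs)))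
coinSum-++ zero    d F = refl
coinSum-++ (suc t) d F = cong₂ _+_ (coinSum-++ t d _) (coinSum-++ t d _)

length-filter-map : ∀ {A B : Set} {p} {P : Pred B p} (P? : Decidable P) (f : A → B) xs →
                    length (filter P? (map f xs)) ≡ length (filter (P? ∘ f) xs)
length-filter-map P? f []       = refl
length-filter-map P? f (x ∷ xs) with does (P? (f x))
... | true  = cong suc (length-filter-map P? f xs)
... | false = length-filter-map P? f xs

length-filter-coins : ∀ {p} {P : Pred (List Bool) p} (P? : Decidable P) t →
  length (filter P? (coins t)) ≡ coinSum t (λ cs → if does (P? cs) then 1 else 0)
length-filter-coins P? zero with does (P? [])
... | true  = refl
... | false = refl
length-filter-coins P? (suc t) = begin
    length (filter P? (map (true ∷_) (coins t) ++ map (false ∷_) (coins t)))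
  ≡⟨ cong length (filter-++ P? (map (true ∷_) (coins t)) _) ⟩
    length (filter P? (map (true ∷_) (coins t)) ++ filter P? (map (false ∷_) (coins t)))
  ≡⟨ length-++ (filter P? (map (true ∷_) (coins t))) ⟩
    length (filter P? (map (true ∷_) (coins t))) + length (filter P? (map (false ∷_) (coins t)))
  ≡⟨ cong₂ _+_ (length-filter-map P? (true ∷_) (coins t)) (length-filter-map P? (false ∷_) (coins t)) ⟩
    length (filter (P? ∘ (true ∷_)) (coins t)) + length (filter (P? ∘ (false ∷_)) (coins t))
  ≡⟨ cong₂ _+_ (length-filter-coins (P? ∘ (true ∷_)) t) (length-filter-coins (P? ∘ (false ∷_)) t) ⟩
    coinSum (suc t) (λ cs → if does (P? cs) then 1 else 0)
  ∎
  where open ≡-Reasoning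

headSym : 𝕊 → Sym
headSym []      = nothing
headSym (b ∷ _) = just b

symString : Sym → 𝕊
symString nothing  = []
symString (just b) = b ∷ []

recode : (Sym → Sym) → 𝕊 → 𝕊
recode g o = symString (g (headSym o))

readBits-symbol : ∀ s r → readBits (s ∷ nothing ∷ r) ≡ symString s
readBits-symbol nothing  r = refl
readBits-symbol (just b) r = refl

output-write-right-blank-left : ∀ s t → output (move left (write nothing (move right (write s t)))) ≡ symString s
output-write-right-blank-left s (tape l c [])      = readBits-symbol s []
output-write-right-blank-left s (tape l c (x ∷ r)) = readBits-symbol s r

headSym-output : ∀ t → headSym (output t) ≡ cur t
headSym-output (tape l nothing  r) = refl
headSym-output (tape l (just b) r) = refl

module _ (M : PTM) (g : Sym → Sym) where

  -- State 2 + q runs M in state q; when M halts, state 1 blanks the cell after the recoded symbol and 0 halts.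
  simulate : Sym → Maybe (Fin (Q M) × Sym × Move) → Maybe (Fin (2 + Q M) × Sym × Move)
  simulate s nothing             = just (suc zero , g s , right)
  simulate s (just (q , s′ , m)) = just (suc (suc q) , s′ , m)

  recodeδ : Fin (2 + Q M) → Sym → Bool → Maybe (Fin (2 + Q M) × Sym × Move)
  recodeδ zero          _ _ = nothing
  recodeδ (suc zero)    _ _ = just (zero , nothing , left)
  recodeδ (suc (suc q)) s c = simulate s (δ M q s c)

  recodeMachine : PTM
  recodeMachine = record { Q = 2 + Q M ; start = suc (suc (start M)) ; δ = recodeδ }

  run-recode-finish : ∀ t cs → 2 ≤ length cs →
                      run recodeMachine cs (suc zero) t ≡ just (output (move left (write nothing t)))
  run-recode-finish t (_ ∷ [])    (s≤s ())
  run-recode-finish t (_ ∷ _ ∷ _) _ = refl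

  run-recode : ∀ cs bs q t {o} → run M cs q t ≡ just o → 2 ≤ length bs →
               run recodeMachine (cs ++ bs) (suc (suc q)) t ≡ just (recode g o)
  run-recode []       bs q t ()    2≤bs
  run-recode (c ∷ cs) bs q t {o} run≡o 2≤bs with δ M q (cur t) c
  ... | just (q′ , s , m) = run-recode cs bs q′ (move m (write s t)) run≡o 2≤bs
  ... | nothing = begin
      run recodeMachine (cs ++ bs) (suc zero) (move right (write (g (cur t)) t))
    ≡⟨ run-recode-finish _ (cs ++ bs) 2≤|cs++bs| ⟩
      just (output (move left (write nothing (move right (write (g (cur t)) t)))))
    ≡⟨ cong just (output-write-right-blank-left (g (cur t)) t) ⟩
      just (symString (g (cur t)))
    ≡⟨ cong (λ s → just (symString (g s))) (headSym-output t) ⟨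
      just (recode g (output t))
    ≡⟨ cong (just ∘ recode g) (just-injective run≡o) ⟩
      just (recode g o)  ∎
    where
    open ≡-Reasoning
    2≤|cs++bs| : 2 ≤ length (cs ++ bs)
    2≤|cs++bs| = ≤-trans 2≤bs (≤-trans (m≤n+m _ (length cs)) (≤-reflexive (sym (length-++ cs))))

  exec-recode : ∀ σ as bs {o} → exec M σ as ≡ just o → 2 ≤ length bs →
                exec recodeMachine σ (as ++ bs) ≡ just (recode g o)
  exec-recode σ as bs = run-recode as bs (start M) (initTape σ)

halts-on : ∀ {M t σ} → HaltsWithin M t σ → ∀ cs → length cs ≡ t → ∃ λ o → exec M σ cs ≡ just o
halts-on {M} {σ = σ} halts cs refl = witness (subst (Is-just ∘ exec M σ) (toList∘fromList cs) (halts (fromList cs)))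
  where
  witness : ∀ {m : Maybe 𝕊} → Is-just m → ∃ λ o → m ≡ just o
  witness (just _) = _ , refl

k*n^k≤[k+2]*n^[k+2] : ∀ k n → k * n ^ k ≤ (k + 2) * n ^ (k + 2)
k*n^k≤[k+2]*n^[k+2] zero    zero    = z≤n
k*n^k≤[k+2]*n^[k+2] (suc k) zero    = ≤-trans (≤-reflexive (*-zeroʳ (suc k))) z≤n
k*n^k≤[k+2]*n^[k+2] k       (suc n) = *-mono-≤ (m≤m+n k 2) (^-monoʳ-≤ (suc n) (m≤m+n k 2))

poly-bound-+2 : ∀ k n → k * n ^ k + k + 2 ≤ (k + 2) * n ^ (k + 2) + (k + 2)
poly-bound-+2 k n = ≤-trans (≤-reflexive (+-assoc (k * n ^ k) k 2)) (+-monoˡ-≤ (k + 2) (k*n^k≤[k+2]*n^[k+2] k n))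

recode-halts : ∀ {M t σ} g → HaltsWithin M t σ → ∀ {t′} → t + 2 ≤ t′ → HaltsWithin (recodeMachine M g) t′ σ
recode-halts {M} {t} {σ} g halts {t′} t+2≤t′ v =
  let o , run≡o = halts-on halts (take t cs) |prefix| in
  subst (Is-just ∘ exec (recodeMachine M g) σ) (take++drop≡id t cs)
        (subst Is-just (sym (exec-recode M g σ (take t cs) (drop t cs) run≡o 2≤|suffix|)) (just _))
  where
  cs = toList v
  t+2≤|cs| : t + 2 ≤ length cs
  t+2≤|cs| = ≤-trans t+2≤t′ (≤-reflexive (sym (length-toList v)))
  |prefix| : length (take t cs) ≡ t
  |prefix| = trans (length-take t cs) (m≤n⇒m⊓n≡m (≤-trans (m≤m+n t 2) t+2≤|cs|))
  2≤|suffix| : 2 ≤ length (drop t cs)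
  2≤|suffix| = begin
    2                   ≡⟨ m+n∸m≡n t 2 ⟨
    t + 2 ∸ t           ≤⟨ ∸-monoˡ-≤ t t+2≤|cs| ⟩
    length cs ∸ t       ≡⟨ length-drop t cs ⟨
    length (drop t cs)  ∎
    where open ≤-Reasoning

recodePoly : PolyPTM → (Sym → Sym) → PolyPTM
recodePoly P g = record
  { machine = recodeMachine (machine P) g
  ; k       = k P + 2
  ; halts   = λ σ → recode-halts g (halts P σ) (poly-bound-+2 (k P) (length σ))
  }

hit : 𝕊 → Maybe 𝕊 → ℕ
hit τ e = if does (Maybe-≡-dec (List-≡-dec _≟B_) e (just τ)) then 1 else 0

hit-≤1 : ∀ τ e → hit τ e ≤ 1
hit-≤1 τ e with does (Maybe-≡-dec (List-≡-dec _≟B_) e (just τ))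
... | true  = ≤-refl
... | false = z≤n

hit-refl : ∀ τ → hit τ (just τ) ≡ 1
hit-refl τ = cong (if_then 1 else 0) (dec-true (Maybe-≡-dec (List-≡-dec _≟B_) (just τ) (just τ)) refl)

hit-map : ∀ (h : 𝕊 → 𝕊) τ o → hit τ (just o) ≤ hit (h τ) (just (h o))
hit-map h τ o with List-≡-dec _≟B_ o τ
... | yes refl = ≤-reflexive (sym (hit-refl (h τ)))
... | no _     = z≤n

hit-disjoint : ∀ {τ τ′} → τ ≢ τ′ → ∀ e → hit τ e + hit τ′ e ≤ 1
hit-disjoint {τ} {τ′} τ≢τ′ e with Maybe-≡-dec (List-≡-dec _≟B_) e (just τ)
... | no _     = hit-≤1 τ′ e
... | yes refl with List-≡-dec _≟B_ τ τ′
...   | yes τ≡τ′ = contradiction τ≡τ′ τ≢τ′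
...   | no _     = ≤-refl

hits : PolyPTM → 𝕊 → 𝕊 → ℕ
hits P σ τ = coinSum (bound P σ) (hit τ ∘ exec (machine P) σ)

Pr-hits : ∀ P σ τ → Pr P σ τ ≡ _/_ (+ hits P σ τ) (2 ^ bound P σ) {{m^n≢0 2 (bound P σ)}}
Pr-hits P σ τ = cong (λ n → _/_ (+ n) (2 ^ bound P σ) {{m^n≢0 2 (bound P σ)}})
                     (length-filter-coins (λ cs → Maybe-≡-dec (List-≡-dec _≟B_) (exec (machine P) σ cs) (just τ)) (bound P σ))

hits-disjoint : ∀ P σ {τ τ′} → τ ≢ τ′ → hits P σ τ + hits P σ τ′ ≤ 2 ^ bound P σ
hits-disjoint P σ {τ} {τ′} τ≢τ′ = begin
    hits P σ τ + hits P σ τ′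
  ≡⟨ coinSum-+ (bound P σ) _ _ ⟨
    coinSum (bound P σ) (λ cs → hit τ (exec (machine P) σ cs) + hit τ′ (exec (machine P) σ cs))
  ≤⟨ coinSum-mono (bound P σ) (λ cs _ → hit-disjoint τ≢τ′ (exec (machine P) σ cs)) ⟩
    coinSum (bound P σ) (λ _ → 1)
  ≡⟨ coinSum-const (bound P σ) 1 ⟩
    2 ^ bound P σ * 1
  ≡⟨ *-identityʳ _ ⟩
    2 ^ bound P σ
  ∎
  where open ≤-Reasoning

hits-recode : ∀ P g σ τ d → 2 ≤ d → bound P σ + d ≡ bound (recodePoly P g) σ →
              2 ^ d * hits P σ τ ≤ hits (recodePoly P g) σ (recode g τ)
hits-recode P g σ τ d 2≤d T+d≡T′ = begin
    2 ^ d * hits P σ τ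
  ≡⟨ coinSum-* T (2 ^ d) _ ⟨
    coinSum T (λ as → 2 ^ d * hit τ (exec M σ as))
  ≤⟨ coinSum-mono T per-prefix ⟩
    coinSum T (λ as → coinSum d (λ bs → hit (recode g τ) (exec M′ σ (as ++ bs))))
  ≡⟨ coinSum-++ T d _ ⟨
    coinSum (T + d) (hit (recode g τ) ∘ exec M′ σ)
  ≡⟨ cong (λ t → coinSum t (hit (recode g τ) ∘ exec M′ σ)) T+d≡T′ ⟩
    hits (recodePoly P g) σ (recode g τ)
  ∎
  where
  open ≤-Reasoning
  T = bound P σ
  M = machine P
  M′ = recodeMachine M g
  per-prefix : ∀ as → length as ≡ T →
               2 ^ d * hit τ (exec M σ as) ≤ coinSum d (λ bs → hit (recode g τ) (exec M′ σ (as ++ bs)))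
  per-prefix as |as| with halts-on (halts P σ) as |as|
  ... | o , run≡o = begin
      2 ^ d * hit τ (exec M σ as)
    ≡⟨ cong (λ e → 2 ^ d * hit τ e) run≡o ⟩
      2 ^ d * hit τ (just o)
    ≤⟨ *-monoʳ-≤ (2 ^ d) (hit-map (recode g) τ o) ⟩
      2 ^ d * hit (recode g τ) (just (recode g o))
    ≡⟨ coinSum-const d _ ⟨
      coinSum d (λ _ → hit (recode g τ) (just (recode g o)))
    ≤⟨ coinSum-mono d (λ bs |bs| → ≤-reflexive (cong (hit (recode g τ))
         (sym (exec-recode M g σ as bs run≡o (≤-trans 2≤d (≤-reflexive (sym |bs|))))))) ⟩
      coinSum d (λ bs → hit (recode g τ) (exec M′ σ (as ++ bs)))
    ∎

toℚᵘ-/ : ∀ a n → toℚᵘ (+ a / suc n) ≃ᵘ mkℚᵘ (+ a) n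
toℚᵘ-/ a n = ℚ.toℚᵘ-fromℚᵘ (mkℚᵘ (+ a) n)

/-≤-/⇔ : ∀ a b m n .{{_ : NonZero m}} .{{_ : NonZero n}} → (+ a / m) ℚ.≤ (+ b / n) ⇔ a * n ≤ b * m
/-≤-/⇔ a b (suc m) (suc n) = mk⇔ to from
  where
  to : (+ a / suc m) ℚ.≤ (+ b / suc n) → a * suc n ≤ b * suc m
  to p with ℚᵘ.≤-respˡ-≃ (toℚᵘ-/ a m) (ℚᵘ.≤-respʳ-≃ (toℚᵘ-/ b n) (ℚ.toℚᵘ-mono-≤ p))
  ... | *≤* q = ℤ.drop‿+≤+ (subst₂ ℤ._≤_ (sym (ℤ.pos-* a (suc n))) (sym (ℤ.pos-* b (suc m))) q)
  from : a * suc n ≤ b * suc m → (+ a / suc m) ℚ.≤ (+ b / suc n)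
  from q = ℚ.toℚᵘ-cancel-≤ (ℚᵘ.≤-respˡ-≃ (ℚᵘ.≃-sym (toℚᵘ-/ a m)) (ℚᵘ.≤-respʳ-≃ (ℚᵘ.≃-sym (toℚᵘ-/ b n))
    (*≤* (subst₂ ℤ._≤_ (ℤ.pos-* a (suc n)) (ℤ.pos-* b (suc m)) (+≤+ q)))))

/-<-/⇔ : ∀ a b m n .{{_ : NonZero m}} .{{_ : NonZero n}} → (+ a / m) ℚ.< (+ b / n) ⇔ a * n < b * m
/-<-/⇔ a b (suc m) (suc n) = mk⇔ to from
  where
  to : (+ a / suc m) ℚ.< (+ b / suc n) → a * suc n < b * suc m
  to p with ℚᵘ.<-respˡ-≃ (toℚᵘ-/ a m) (ℚᵘ.<-respʳ-≃ (toℚᵘ-/ b n) (ℚ.toℚᵘ-mono-< p))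
  ... | *<* q = ℤ.drop‿+<+ (subst₂ ℤ._<_ (sym (ℤ.pos-* a (suc n))) (sym (ℤ.pos-* b (suc m))) q)
  from : a * suc n < b * suc m → (+ a / suc m) ℚ.< (+ b / suc n)
  from q = ℚ.toℚᵘ-cancel-< (ℚᵘ.<-respˡ-≃ (ℚᵘ.≃-sym (toℚᵘ-/ a m)) (ℚᵘ.<-respʳ-≃ (ℚᵘ.≃-sym (toℚᵘ-/ b n))
    (*<* (subst₂ ℤ._<_ (ℤ.pos-* a (suc n)) (ℤ.pos-* b (suc m)) (+<+ q)))))

Pr-recode : ∀ P g σ τ → Pr P σ τ ℚ.≤ Pr (recodePoly P g) σ (recode g τ)
Pr-recode P g σ τ =
  subst₂ ℚ._≤_ (sym (Pr-hits P σ τ)) (sym (Pr-hits P′ σ (recode g τ)))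
    (Equivalence.from (/-≤-/⇔ (hits P σ τ) (hits P′ σ (recode g τ)) (2 ^ T) (2 ^ T′) {{m^n≢0 2 T}} {{m^n≢0 2 T′}})
      cross-multiplied)
  where
  open ≤-Reasoning
  P′ = recodePoly P g
  T = bound P σ
  T′ = bound P′ σ
  d = T′ ∸ T
  T+2≤T′ : T + 2 ≤ T′
  T+2≤T′ = poly-bound-+2 (k P) (length σ)
  T+d≡T′ : T + d ≡ T′
  T+d≡T′ = m+[n∸m]≡n (≤-trans (m≤m+n T 2) T+2≤T′)
  2≤d : 2 ≤ d
  2≤d = ≤-trans (≤-reflexive (sym (m+n∸m≡n T 2))) (∸-monoˡ-≤ T T+2≤T′)
  rearrange : ∀ h a b → h * (a * b) ≡ b * h * a
  rearrange = solve-∀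
  cross-multiplied : hits P σ τ * 2 ^ T′ ≤ hits P′ σ (recode g τ) * 2 ^ T
  cross-multiplied = begin
      hits P σ τ * 2 ^ T′
    ≡⟨ cong (λ t → hits P σ τ * 2 ^ t) T+d≡T′ ⟨
      hits P σ τ * 2 ^ (T + d)
    ≡⟨ cong (hits P σ τ *_) (^-distribˡ-+-* 2 T d) ⟩
      hits P σ τ * (2 ^ T * 2 ^ d)
    ≡⟨ rearrange (hits P σ τ) (2 ^ T) (2 ^ d) ⟩
      2 ^ d * hits P σ τ * 2 ^ T
    ≤⟨ *-monoˡ-≤ (2 ^ T) (hits-recode P g σ τ d 2≤d T+d≡T′) ⟩
      hits P′ σ (recode g τ) * 2 ^ T
    ∎

½<⅔ : (+ 1 / 2) ℚ.< (+ 2 / 3)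
½<⅔ = Equivalence.from (/-<-/⇔ 1 2 2 3) (n<1+n 3)

shares-overflow : ∀ N C K → 2 * N ≤ C * 3 → 1 * N < K * 2 → N < C + K
shares-overflow N C K ⅔≤C ½<K = *-cancelˡ-< 6 N (C + K) (begin-strict
    6 * N                       ≤⟨ m≤m+n (6 * N) N ⟩
    6 * N + N                   ≡⟨ sevenfold N ⟩
    2 * (2 * N) + 3 * (1 * N)   <⟨ +-mono-≤-< (*-monoʳ-≤ 2 ⅔≤C) (*-monoʳ-< 3 ½<K) ⟩
    2 * (C * 3) + 3 * (K * 2)   ≡⟨ sixfold C K ⟩
    6 * (C + K)                 ∎)
  where
  open ≤-Reasoning
  sevenfold : ∀ N → 6 * N + N ≡ 2 * (2 * N) + 3 * (1 * N)
  sevenfold = solve-∀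
  sixfold : ∀ C K → 2 * (C * 3) + 3 * (K * 2) ≡ 6 * (C + K)
  sixfold = solve-∀

InL⇔likely≡[] : ∀ P σ τ → (+ 2 / 3) ℚ.≤ Pr P σ τ → InL P σ ⇔ τ ≡ []
InL⇔likely≡[] P σ []      likely = mk⇔ (λ _ → refl) (λ _ → ℚ.<-≤-trans ½<⅔ likely)
InL⇔likely≡[] P σ (b ∷ τ) likely = mk⇔ (λ inL → contradiction (hits-disjoint P σ (λ ())) (<⇒≱ (overflow inL))) (λ ())
  where
  N = 2 ^ bound P σ
  instance
    N≢0 : NonZero N
    N≢0 = m^n≢0 2 (bound P σ)
  overflow : InL P σ → N < hits P σ (b ∷ τ) + hits P σ []
  overflow inL = shares-overflow N (hits P σ (b ∷ τ)) (hits P σ [])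
    (Equivalence.to (/-≤-/⇔ 2 (hits P σ (b ∷ τ)) 3 N) (subst (+ 2 / 3 ℚ.≤_) (Pr-hits P σ (b ∷ τ)) likely))
    (Equivalence.to (/-<-/⇔ 1 (hits P σ []) 2 N) (subst (+ 1 / 2 ℚ.<_) (Pr-hits P σ []) inL))

eraseTrue : Sym → Sym
eraseTrue (just true) = nothing
eraseTrue s           = s

blankTest : Sym → Sym
blankTest nothing  = just true
blankTest (just _) = just false

recode-eraseTrue≡[]⇔ : ∀ b → recode eraseTrue (b ∷ []) ≡ [] ⇔ b ≡ true
recode-eraseTrue≡[]⇔ true  = mk⇔ (λ _ → refl) (λ _ → refl)
recode-eraseTrue≡[]⇔ false = mk⇔ (λ ()) (λ ())

recode-blankTest : ∀ b τ → (b ≡ true ⇔ τ ≡ []) → recode blankTest τ ≡ b ∷ []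
recode-blankTest true  []      _   = refl
recode-blankTest true  (_ ∷ _) b⇔τ = contradiction (Equivalence.to b⇔τ refl) (λ ())
recode-blankTest false []      b⇔τ = contradiction (Equivalence.from b⇔τ refl) (λ ())
recode-blankTest false (_ ∷ _) _   = refl

lemma4p6 : (L : Language) →
    BPP L ⇔ (Σ PolyPTM λ P → NonErratic P × (∀ σ → (L σ ≡ true) ⇔ InL P σ))
lemma4p6 L = mk⇔ toRFP fromRFP
  where
  toRFP : BPP L → Σ PolyPTM λ P → NonErratic P × (∀ σ → (L σ ≡ true) ⇔ InL P σ)
  toRFP (P , correct) = P′ , (λ σ → _ , likely σ) , membership
    where
    P′ = recodePoly P eraseTrue
    likely : ∀ σ → (+ 2 / 3) ℚ.≤ Pr P′ σ (recode eraseTrue (χ L σ))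
    likely σ = ℚ.≤-trans (correct σ) (Pr-recode P eraseTrue σ (χ L σ))
    membership : ∀ σ → (L σ ≡ true) ⇔ InL P′ σ
    membership σ = ⇔.trans (⇔.sym (recode-eraseTrue≡[]⇔ (L σ))) (⇔.sym (InL⇔likely≡[] P′ σ _ (likely σ)))
  fromRFP : (Σ PolyPTM λ P → NonErratic P × (∀ σ → (L σ ≡ true) ⇔ InL P σ)) → BPP L
  fromRFP (P , nonErratic , membership) = recodePoly P blankTest , correct
    where
    correct : ∀ σ → (+ 2 / 3) ℚ.≤ Pr (recodePoly P blankTest) σ (χ L σ)
    correct σ with nonErratic σ
    ... | τ , likely = subst (λ τ′ → (+ 2 / 3) ℚ.≤ Pr (recodePoly P blankTest) σ τ′)
                             (recode-blankTest (L σ) τ (⇔.trans (membership σ) (InL⇔likely≡[] P σ τ likely)))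
                             (ℚ.≤-trans likely (Pr-recode P blankTest σ τ))
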